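{- Let $P$ be a finite poset with $n$ elements. The map $S\mapsto (T,\, i_*(S)-1,\, p_*(S))$, where for all $p\in P$ \[ T(p) = \begin{cases} \min S(p) &\text{if } \min S(p) < i_*(S), \\ \min S(p)-1 &\text{otherwise},\end{cases}\] is a bijection from $\mathcal{L}^{+1}(P)$ to the set of triples $(T,i,p)$ with $T\in\mathcal{L}(P)$, $i\in\{0,1,\dots,n\}$, and $p$ a maximal element of $T^{ -1}(\{1,\dots,i\})$.
   Context: A linear extension of $P$ is an order-preserving bijection $T:P\to[n]$; $\mathcal{L}(P)$ is their set. A barely set-valued linear extension is a map $S$ from $P$ to nonempty subsets of $\mathbb{N}$ whose values are pairwise disjoint with union $[n+1]$, with $\max S(p)<\min S(p')$ whenever $p<p'$, and exactly one element $p_*(S)$ with $\#S(p_*(S))=2$ (all others singletons); $\mathcal{L}^{+1}(P)$ is their set, and $i_*(S)=\max S(p_*(S))$. -}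

module Defs where

open import Data.Nat using (ℕ; zero; suc; _+_; _∸_; _≤_; _<_)
open import Data.Fin using (Fin)
open import Data.Bool using (Bool; true)
open import Data.Product using (Σ; Σ-syntax; ∃; _×_; _,_)
open import Data.Sum using (_⊎_)
open import Relation.Nullary using (¬_)
open import Relation.Binary.PropositionalEquality using (_≡_; _≢_)
open import Relation.Binary.Structures using (IsPartialOrder)
open import Function.Bundles using (_⇔_)

record FinPoset (n : ℕ) : Set₁ where
  field
    _≼_       : Fin n → Fin n → Set
    isPartialOrder : IsPartialOrder _≡_ _≼_

  _≺_ : Fin n → Fin n → Set
  p ≺ q = (p ≼ q) × (p ≢ q)

SubsetN : Set
SubsetN = ℕ → Bool

_∈ˢ_ : ℕ → SubsetN → Set
k ∈ˢ A = A k ≡ true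

IsSingleton : SubsetN → Set
IsSingleton A = Σ[ a ∈ ℕ ] (∀ k → (k ∈ˢ A) ⇔ (k ≡ a))

HasSize2 : SubsetN → Set
HasSize2 A = Σ[ a ∈ ℕ ] Σ[ b ∈ ℕ ] (a < b) × (∀ k → (k ∈ˢ A) ⇔ ((k ≡ a) ⊎ (k ≡ b)))

IsMin : SubsetN → ℕ → Set
IsMin A m = (m ∈ˢ A) × (∀ k → k ∈ˢ A → m ≤ k)

IsMax : SubsetN → ℕ → Set
IsMax A m = (m ∈ˢ A) × (∀ k → k ∈ˢ A → k ≤ m)

module _ {n : ℕ} (P : FinPoset n) where
  open FinPoset P

  IsLinearExtension : (Fin n → ℕ) → Set
  IsLinearExtension T =
      (∀ p → (1 ≤ T p) × (T p ≤ n))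
    × (∀ p q → T p ≡ T q → p ≡ q)
    × (∀ k → 1 ≤ k → k ≤ n → Σ[ p ∈ Fin n ] T p ≡ k)
    × (∀ p q → p ≺ q → T p < T q)

  IsBarelySetValued : (Fin n → SubsetN) → Set
  IsBarelySetValued S =
      (∀ p → Σ[ k ∈ ℕ ] k ∈ˢ S p)
    × (∀ p q k → k ∈ˢ S p → k ∈ˢ S q → p ≡ q)
    × (∀ k → (Σ[ p ∈ Fin n ] k ∈ˢ S p) ⇔ ((1 ≤ k) × (k ≤ suc n)))
    × (∀ p p' → p ≺ p' → ∀ a b → a ∈ˢ S p → b ∈ˢ S p' → a < b)
    × (Σ[ p ∈ Fin n ] HasSize2 (S p) × (∀ q → q ≢ p → IsSingleton (S q)))

  IsMaximalInPrefix : (Fin n → ℕ) → ℕ → Fin n → Set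
  IsMaximalInPrefix T i p =
      ((1 ≤ T p) × (T p ≤ i))
    × (∀ q → p ≺ q → ¬ ((1 ≤ T q) × (T q ≤ i)))

  IsTargetTriple : (Fin n → ℕ) → ℕ → Fin n → Set
  IsTargetTriple T i p = IsLinearExtension T × (i ≤ n) × IsMaximalInPrefix T i p

  -- The graph of the map S ↦ (T, i_*(S) - 1, p_*(S)):
  -- p = p_*(S) (the element with #S(p) = 2), i_*(S) = max S(p_*(S)), and
  -- T(q) = min S(q) if min S(q) < i_*(S), else min S(q) - 1.
  MapsTo : (Fin n → SubsetN) → (Fin n → ℕ) → ℕ → Fin n → Set
  MapsTo S T i p =
      HasSize2 (S p)
    × Σ[ istar ∈ ℕ ] IsMax (S p) istar
        × (i ≡ istar ∸ 1)
        × (∀ q → Σ[ m ∈ ℕ ] IsMin (S q) m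
                   × (m < istar → T q ≡ m)
                   × (¬ (m < istar) → T q ≡ m ∸ 1))

{-# OPTIONS --safe #-}

-- A barely set-valued S is determined by its doubleton element p*, the larger label b* of p*, and
-- the minima min S(q). The minima are exactly the labels in [n+1] other than b*, so closing the gap
-- at b* (punchOut) turns them into a linear extension T; p* is maximal among the elements labelled
-- at most b* − 1 because everything above p* carries labels above b*. Conversely, reopening the gap at
-- i+1 (punchIn) and adding i+1 to the label set of p recovers S, so the map is a bijection.
module Submission where

open import Defs
open import Data.Nat using (ℕ; suc; _∸_; _≤_; _<_; z≤n; s≤s; s≤s⁻¹; _<?_; _≟_; >-nonZero)
open import Data.Nat.Properties
open import Data.Fin using (Fin) renaming (_≟_ to _≟ᶠ_)
open import Data.Bool using (true)
open import Data.Bool.Properties using (⇔→≡)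
open import Data.Product using (Σ; Σ-syntax; _×_; _,_; proj₁; proj₂)
open import Data.Sum using (_⊎_; inj₁; inj₂)
open import Function.Bundles using (_⇔_; mk⇔; Equivalence)
open import Function.Properties.Equivalence using () renaming (trans to ⇔-trans; sym to ⇔-sym)
open import Relation.Nullary using (¬_; Dec; yes; no; does; contradiction)
open import Relation.Nullary.Decidable using (_⊎-dec_; _×-dec_)
open import Relation.Binary.PropositionalEquality
  using (_≡_; _≢_; ≢-sym; refl; sym; trans; cong; cong₂; subst; subst₂; module ≡-Reasoning)

open Equivalence using (to; from)
open ≡-Reasoning

does≡true⇔ : ∀ {A : Set} (a? : Dec A) → does a? ≡ true ⇔ A
does≡true⇔ (yes a) = mk⇔ (λ _ → a) (λ _ → refl)
does≡true⇔ (no ¬a) = mk⇔ (λ ()) (λ a → contradiction a ¬a)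

≮∧≢⇒> : ∀ {m b} → ¬ m < b → m ≢ b → b < m
≮∧≢⇒> m≮b m≢b = ≤∧≢⇒< (≮⇒≥ m≮b) (≢-sym m≢b)

-- punchOut b closes the gap at b and punchIn b opens it, as Data.Fin's punchOut/punchIn do;
-- punchOut b b is a junk value.

punchOut : ℕ → ℕ → ℕ
punchOut b m with m <? b
... | yes _ = m
... | no  _ = m ∸ 1

punchIn : ℕ → ℕ → ℕ
punchIn b t with t <? b
... | yes _ = t
... | no  _ = suc t

punchOut-< : ∀ {b m} → m < b → punchOut b m ≡ m
punchOut-< {b} {m} m<b with m <? b
... | yes _   = refl
... | no  m≮b = contradiction m<b m≮b

punchOut-≮ : ∀ {b m} → ¬ m < b → punchOut b m ≡ m ∸ 1
punchOut-≮ {b} {m} m≮b with m <? b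
... | yes m<b = contradiction m<b m≮b
... | no  _   = refl

≡punchOut⇔ : ∀ {b m t} → t ≡ punchOut b m ⇔ ((m < b → t ≡ m) × (¬ m < b → t ≡ m ∸ 1))
≡punchOut⇔ {b} {m} {t} = mk⇔
  (λ t≡ → (λ m<b → trans t≡ (punchOut-< m<b)) , (λ m≮b → trans t≡ (punchOut-≮ m≮b)))
  by-cases
  where
  by-cases : (m < b → t ≡ m) × (¬ m < b → t ≡ m ∸ 1) → t ≡ punchOut b m
  by-cases (below , above) with m <? b
  ... | yes m<b = below m<b
  ... | no  m≮b = above m≮b

punchIn-< : ∀ {b t} → t < b → punchIn b t ≡ t
punchIn-< {b} {t} t<b with t <? b
... | yes _   = refl
... | no  t≮b = contradiction t<b t≮b

punchIn-≮ : ∀ {b t} → ¬ t < b → punchIn b t ≡ suc t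
punchIn-≮ {b} {t} t≮b with t <? b
... | yes t<b = contradiction t<b t≮b
... | no  _   = refl

punchIn-<-gap : ∀ {b t} → t < b → punchIn b t < b
punchIn-<-gap {b} t<b = subst (_< b) (sym (punchIn-< t<b)) t<b

gap-<-punchIn : ∀ {b t} → ¬ t < b → b < punchIn b t
gap-<-punchIn {b} t≮b = subst (b <_) (sym (punchIn-≮ t≮b)) (s≤s (≮⇒≥ t≮b))

punchIn≢ : ∀ b t → punchIn b t ≢ b
punchIn≢ b t with t <? b
... | yes t<b = <⇒≢ t<b
... | no  t≮b = λ 1+t≡b → t≮b (subst (t <_) 1+t≡b (n<1+n t))

punchOut-punchIn : ∀ b t → punchOut b (punchIn b t) ≡ t
punchOut-punchIn b t with t <? b
... | yes t<b = punchOut-< t<b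
... | no  t≮b = punchOut-≮ (λ 1+t<b → t≮b (<-trans (n<1+n t) 1+t<b))

punchIn-punchOut : ∀ {b m} → m ≢ b → punchIn b (punchOut b m) ≡ m
punchIn-punchOut {b} {m} m≢b with m <? b
... | yes m<b = punchIn-< m<b
... | no  m≮b with ≮∧≢⇒> m≮b m≢b
...   | s≤s b≤m-1 = punchIn-≮ (≤⇒≯ b≤m-1)

punchIn-injective : ∀ b {t t'} → punchIn b t ≡ punchIn b t' → t ≡ t'
punchIn-injective b {t} {t'} eq = begin
  t                            ≡⟨ sym (punchOut-punchIn b t) ⟩
  punchOut b (punchIn b t)     ≡⟨ cong (punchOut b) eq ⟩
  punchOut b (punchIn b t')    ≡⟨ punchOut-punchIn b t' ⟩
  t'                           ∎

punchOut-injective : ∀ {b m m'} → m ≢ b → m' ≢ b → punchOut b m ≡ punchOut b m' → m ≡ m'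
punchOut-injective {b} {m} {m'} m≢b m'≢b eq = begin
  m                            ≡⟨ sym (punchIn-punchOut m≢b) ⟩
  punchIn b (punchOut b m)     ≡⟨ cong (punchIn b) eq ⟩
  punchIn b (punchOut b m')    ≡⟨ punchIn-punchOut m'≢b ⟩
  m'                           ∎

punchIn-mono-< : ∀ {b t t'} → t < t' → punchIn b t < punchIn b t'
punchIn-mono-< {b} {t} {t'} t<t' with t <? b | t' <? b
... | yes _   | yes _    = t<t'
... | yes _   | no  _    = m≤n⇒m≤1+n t<t'
... | no  t≮b | yes t'<b = contradiction (<-trans t<t' t'<b) t≮b
... | no  _   | no  _    = s≤s t<t'

punchOut-mono-< : ∀ {b m m'} → m ≢ b → m' ≢ b → m < m' → punchOut b m < punchOut b m'
punchOut-mono-< {b} {m} {m'} m≢b m'≢b m<m' with m <? b | m' <? b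
... | yes _   | yes _    = m<m'
... | yes m<b | no  m'≮b = <-≤-trans m<b (<⇒≤pred (≮∧≢⇒> m'≮b m'≢b))
... | no  m≮b | yes m'<b = contradiction (<-trans m<m' m'<b) m≮b
... | no  m≮b | no  _    =
  pred-mono-< {{>-nonZero (≤-<-trans z≤n (≮∧≢⇒> m≮b m≢b))}} m<m'

punchIn-range : ∀ {n b t} → 1 ≤ t → t ≤ n → (1 ≤ punchIn b t) × (punchIn b t ≤ suc n)
punchIn-range {b = b} {t} 1≤t t≤n with t <? b
... | yes _ = 1≤t , m≤n⇒m≤1+n t≤n
... | no  _ = s≤s z≤n , s≤s t≤n

punchOut-range : ∀ {n b m} → 1 ≤ b → b ≤ suc n → m ≢ b → 1 ≤ m → m ≤ suc n →
                 (1 ≤ punchOut b m) × (punchOut b m ≤ n)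
punchOut-range {b = b} {m} 1≤b b≤1+n m≢b 1≤m m≤1+n with m <? b
... | yes m<b = 1≤m , s≤s⁻¹ (≤-trans m<b b≤1+n)
... | no  m≮b with ≮∧≢⇒> m≮b m≢b | m≤1+n
...   | s≤s b≤m-1 | s≤s m-1≤n = ≤-trans 1≤b b≤m-1 , m-1≤n

IsMin-unique : ∀ {A m m'} → IsMin A m → IsMin A m' → m ≡ m'
IsMin-unique (m∈A , m≤) (m'∈A , m'≤) = ≤-antisym (m≤ _ m'∈A) (m'≤ _ m∈A)

IsMax-unique : ∀ {A m m'} → IsMax A m → IsMax A m' → m ≡ m'
IsMax-unique (m∈A , ≤m) (m'∈A , ≤m') = ≤-antisym (≤m' _ m∈A) (≤m _ m'∈A)

pair-IsMin : ∀ {A a b} → a < b → (∀ k → k ∈ˢ A ⇔ ((k ≡ a) ⊎ (k ≡ b))) → IsMin A a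
pair-IsMin {a = a} a<b A⇔ = from (A⇔ a) (inj₁ refl) , λ k k∈A → a≤ (to (A⇔ k) k∈A)
  where
  a≤ : ∀ {k} → (k ≡ a) ⊎ (k ≡ _) → a ≤ k
  a≤ (inj₁ refl) = ≤-refl
  a≤ (inj₂ refl) = <⇒≤ a<b

pair-IsMax : ∀ {A a b} → a < b → (∀ k → k ∈ˢ A ⇔ ((k ≡ a) ⊎ (k ≡ b))) → IsMax A b
pair-IsMax {b = b} a<b A⇔ = from (A⇔ b) (inj₂ refl) , λ k k∈A → ≤b (to (A⇔ k) k∈A)
  where
  ≤b : ∀ {k} → (k ≡ _) ⊎ (k ≡ b) → k ≤ b
  ≤b (inj₁ refl) = <⇒≤ a<b
  ≤b (inj₂ refl) = ≤-refl

singleton-IsMin : ∀ {A a} → (∀ k → k ∈ˢ A ⇔ (k ≡ a)) → IsMin A a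
singleton-IsMin {a = a} A⇔ = from (A⇔ a) refl , λ k k∈A → ≤-reflexive (sym (to (A⇔ k) k∈A))

HasSize2⇒¬IsSingleton : ∀ {A} → HasSize2 A → ¬ IsSingleton A
HasSize2⇒¬IsSingleton (a , b , a<b , A⇔) (c , A⇔c) =
  <⇒≢ a<b (trans (to (A⇔c a) (from (A⇔ a) (inj₁ refl))) (sym (to (A⇔c b) (from (A⇔ b) (inj₂ refl)))))

-- The inverse map: S(q) = {punchIn (i+1) (T q)}, together with i+1 when q = p.
Lifted : ∀ {n} → (Fin n → ℕ) → ℕ → Fin n → Fin n → ℕ → Set
Lifted T i p q k = (k ≡ punchIn (suc i) (T q)) ⊎ ((q ≡ p) × (k ≡ suc i))

module BarelySetValued {n : ℕ} (P : FinPoset n) {S : Fin n → SubsetN}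
                       (bsv : IsBarelySetValued P S) where
  open FinPoset P

  disjoint : ∀ p q k → k ∈ˢ S p → k ∈ˢ S q → p ≡ q
  disjoint = proj₁ (proj₂ bsv)

  covers : ∀ k → (Σ[ p ∈ Fin n ] k ∈ˢ S p) ⇔ ((1 ≤ k) × (k ≤ suc n))
  covers = proj₁ (proj₂ (proj₂ bsv))

  ordered : ∀ p p' → p ≺ p' → ∀ a b → a ∈ˢ S p → b ∈ˢ S p' → a < b
  ordered = proj₁ (proj₂ (proj₂ (proj₂ bsv)))

  p* : Fin n
  p* = proj₁ (proj₂ (proj₂ (proj₂ (proj₂ bsv))))

  doubleton : HasSize2 (S p*)
  doubleton = proj₁ (proj₂ (proj₂ (proj₂ (proj₂ (proj₂ bsv)))))

  singleton : ∀ q → q ≢ p* → IsSingleton (S q)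
  singleton = proj₂ (proj₂ (proj₂ (proj₂ (proj₂ (proj₂ bsv)))))

  a* b* : ℕ
  a* = proj₁ doubleton
  b* = proj₁ (proj₂ doubleton)

  a*<b* : a* < b*
  a*<b* = proj₁ (proj₂ (proj₂ doubleton))

  S[p*]⇔ : ∀ k → k ∈ˢ S p* ⇔ ((k ≡ a*) ⊎ (k ≡ b*))
  S[p*]⇔ = proj₂ (proj₂ (proj₂ doubleton))

  b*-IsMax : IsMax (S p*) b*
  b*-IsMax = pair-IsMax a*<b* S[p*]⇔

  in-range : ∀ {q k} → k ∈ˢ S q → (1 ≤ k) × (k ≤ suc n)
  in-range {q} {k} k∈ = to (covers k) (q , k∈)

  HasSize2⇒≡p* : ∀ {q} → HasSize2 (S q) → q ≡ p*
  HasSize2⇒≡p* {q} size2 with q ≟ᶠ p*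
  ... | yes q≡p* = q≡p*
  ... | no  q≢p* = contradiction (singleton q q≢p*) (HasSize2⇒¬IsSingleton size2)

  minimum : ∀ q → Σ ℕ (IsMin (S q))
  minimum q with q ≟ᶠ p*
  ... | yes refl = a* , pair-IsMin a*<b* S[p*]⇔
  ... | no  q≢p* = proj₁ (singleton q q≢p*) , singleton-IsMin (proj₂ (singleton q q≢p*))

  min : Fin n → ℕ
  min q = proj₁ (minimum q)

  min-IsMin : ∀ q → IsMin (S q) (min q)
  min-IsMin q = proj₂ (minimum q)

  min∈S : ∀ q → min q ∈ˢ S q
  min∈S q = proj₁ (min-IsMin q)

  min[p*]<b* : min p* < b*
  min[p*]<b* = subst (_< b*) (IsMin-unique (pair-IsMin a*<b* S[p*]⇔) (min-IsMin p*)) a*<b*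

  ∈S⇔ : ∀ q k → k ∈ˢ S q ⇔ ((k ≡ min q) ⊎ ((q ≡ p*) × (k ≡ b*)))
  ∈S⇔ q k = mk⇔ (members q) λ { (inj₁ refl) → min∈S q ; (inj₂ (refl , refl)) → proj₁ b*-IsMax }
    where
    members : ∀ q → k ∈ˢ S q → (k ≡ min q) ⊎ ((q ≡ p*) × (k ≡ b*))
    members q k∈ with q ≟ᶠ p*
    ... | yes refl with to (S[p*]⇔ k) k∈
    ...   | inj₁ k≡a* = inj₁ k≡a*
    ...   | inj₂ k≡b* = inj₂ (refl , k≡b*)
    members q k∈ | no q≢p* = inj₁ (to (proj₂ (singleton q q≢p*) k) k∈)

  min≢b* : ∀ q → min q ≢ b*
  min≢b* q min≡b* with disjoint q p* (min q) (min∈S q) (subst (_∈ˢ S p*) (sym min≡b*) (proj₁ b*-IsMax))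
  ... | refl = <⇒≢ min[p*]<b* min≡b*

  1≤b* : 1 ≤ b*
  1≤b* = proj₁ (in-range (proj₁ b*-IsMax))

  b*≤1+n : b* ≤ suc n
  b*≤1+n = proj₂ (in-range (proj₁ b*-IsMax))

  T* : Fin n → ℕ
  T* q = punchOut b* (min q)

  i* : ℕ
  i* = b* ∸ 1

  MapsTo-T* : MapsTo P S T* i* p*
  MapsTo-T* = doubleton , b* , b*-IsMax , refl , λ q → min q , min-IsMin q , to ≡punchOut⇔ refl

  MapsTo⇒canonical : ∀ {T i p} → MapsTo P S T i p → (∀ q → T q ≡ T* q) × (i ≡ i*) × (p ≡ p*)
  MapsTo⇒canonical {T} (size2 , b , b-IsMax , i≡ , T-spec) with HasSize2⇒≡p* size2
  ... | refl with IsMax-unique b-IsMax b*-IsMax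
  ... | refl = T≗T* , i≡ , refl
    where
    T≗T* : ∀ q → T q ≡ T* q
    T≗T* q = let (m , m-IsMin , T-cases) = T-spec q in
      trans (from ≡punchOut⇔ T-cases) (cong (punchOut b*) (IsMin-unique m-IsMin (min-IsMin q)))

  MapsTo⇒∈S⇔Lifted : ∀ {T i p} → MapsTo P S T i p → ∀ q k → k ∈ˢ S q ⇔ Lifted T i p q k
  MapsTo⇒∈S⇔Lifted {T} maps q k with MapsTo⇒canonical maps
  ... | T≗T* , refl , refl =
    subst₂ (λ m b → k ∈ˢ S q ⇔ ((k ≡ m) ⊎ ((q ≡ p*) × (k ≡ b)))) (sym min≡) (sym 1+i*≡b*) (∈S⇔ q k)
    where
    1+i*≡b* : suc i* ≡ b*
    1+i*≡b* = suc-pred b* {{>-nonZero 1≤b*}}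
    min≡ : punchIn (suc i*) (T q) ≡ min q
    min≡ = begin
      punchIn (suc i*) (T q)           ≡⟨ cong₂ punchIn 1+i*≡b* (T≗T* q) ⟩
      punchIn b* (punchOut b* (min q)) ≡⟨ punchIn-punchOut (min≢b* q) ⟩
      min q                            ∎

  T*-range : ∀ q → (1 ≤ T* q) × (T* q ≤ n)
  T*-range q = let (1≤min , min≤1+n) = in-range (min∈S q) in
    punchOut-range 1≤b* b*≤1+n (min≢b* q) 1≤min min≤1+n

  T*-injective : ∀ q q' → T* q ≡ T* q' → q ≡ q'
  T*-injective q q' eq = disjoint q q' (min q')
    (subst (_∈ˢ S q) (punchOut-injective (min≢b* q) (min≢b* q') eq) (min∈S q)) (min∈S q')

  -- The label punchIn b* k ≠ b* belongs to some S q, where it can only be min q.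
  T*-surjective : ∀ k → 1 ≤ k → k ≤ n → Σ[ q ∈ Fin n ] T* q ≡ k
  T*-surjective k 1≤k k≤n with from (covers (punchIn b* k)) (punchIn-range 1≤k k≤n)
  ... | q , k'∈ with to (∈S⇔ q _) k'∈
  ...   | inj₁ k'≡min = q , (begin
          punchOut b* (min q)            ≡⟨ cong (punchOut b*) (sym k'≡min) ⟩
          punchOut b* (punchIn b* k)     ≡⟨ punchOut-punchIn b* k ⟩
          k                              ∎)
  ...   | inj₂ (_ , k'≡b*) = contradiction k'≡b* (punchIn≢ b* k)

  T*-monotone : ∀ q q' → q ≺ q' → T* q < T* q'
  T*-monotone q q' q≺q' =
    punchOut-mono-< (min≢b* q) (min≢b* q') (ordered q q' q≺q' _ _ (min∈S q) (min∈S q'))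

  p*-maximal : IsMaximalInPrefix P T* i* p*
  p*-maximal = (subst (1 ≤_) (sym T*p*≡) (proj₁ (in-range (min∈S p*))) ,
                subst (_≤ i*) (sym T*p*≡) (<⇒≤pred min[p*]<b*)) , nothing-above
    where
    T*p*≡ : T* p* ≡ min p*
    T*p*≡ = punchOut-< min[p*]<b*
    nothing-above : ∀ q → p* ≺ q → ¬ ((1 ≤ T* q) × (T* q ≤ i*))
    nothing-above q p*≺q (_ , T*q≤i*) =
      <⇒≱ (pred-mono-< {{>-nonZero 1≤b*}} b*<min) (subst (_≤ i*) (punchOut-≮ (<⇒≯ b*<min)) T*q≤i*)
      where
      b*<min : b* < min q
      b*<min = ordered p* q p*≺q b* (min q) (proj₁ b*-IsMax) (min∈S q)

  IsTargetTriple-T* : IsTargetTriple P T* i* p*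
  IsTargetTriple-T* = (T*-range , T*-injective , T*-surjective , T*-monotone) ,
                      ∸-monoˡ-≤ 1 b*≤1+n , p*-maximal

module _ {n : ℕ} (P : FinPoset n) where

  MapsTo-unique : (S : Fin n → SubsetN) → IsBarelySetValued P S →
    ∀ T i p T' i' p' → MapsTo P S T i p → MapsTo P S T' i' p' →
    (∀ q → T q ≡ T' q) × (i ≡ i') × (p ≡ p')
  MapsTo-unique S bsv T i p T' i' p' maps maps' =
    let open BarelySetValued P bsv
        (T≗T* , i≡i* , p≡p*) = MapsTo⇒canonical maps
        (T'≗T* , i'≡i* , p'≡p*) = MapsTo⇒canonical maps'
    in (λ q → trans (T≗T* q) (sym (T'≗T* q))) , trans i≡i* (sym i'≡i*) , trans p≡p* (sym p'≡p*)

  MapsTo-injective : (S S' : Fin n → SubsetN) → IsBarelySetValued P S → IsBarelySetValued P S' →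
    ∀ T i p → MapsTo P S T i p → MapsTo P S' T i p → ∀ q k → S q k ≡ S' q k
  MapsTo-injective S S' bsv bsv' T i p maps maps' q k =
    ⇔→≡ (⇔-trans (BarelySetValued.MapsTo⇒∈S⇔Lifted P bsv maps q k)
                 (⇔-sym (BarelySetValued.MapsTo⇒∈S⇔Lifted P bsv' maps' q k)))

  module Lift {T : Fin n → ℕ} {i : ℕ} {p : Fin n} (target : IsTargetTriple P T i p) where
    open FinPoset P

    T-range : ∀ q → (1 ≤ T q) × (T q ≤ n)
    T-range = proj₁ (proj₁ target)

    T-injective : ∀ q q' → T q ≡ T q' → q ≡ q'
    T-injective = proj₁ (proj₂ (proj₁ target))

    T-surjective : ∀ k → 1 ≤ k → k ≤ n → Σ[ q ∈ Fin n ] T q ≡ k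
    T-surjective = proj₁ (proj₂ (proj₂ (proj₁ target)))

    T-monotone : ∀ q q' → q ≺ q' → T q < T q'
    T-monotone = proj₂ (proj₂ (proj₂ (proj₁ target)))

    i≤n : i ≤ n
    i≤n = proj₁ (proj₂ target)

    Tp≤i : T p ≤ i
    Tp≤i = proj₂ (proj₁ (proj₂ (proj₂ target)))

    nothing-above : ∀ q → p ≺ q → ¬ ((1 ≤ T q) × (T q ≤ i))
    nothing-above = proj₂ (proj₂ (proj₂ target))

    b : ℕ
    b = suc i

    lifted : Fin n → ℕ
    lifted q = punchIn b (T q)

    Lifted? : ∀ q k → Dec (Lifted T i p q k)
    Lifted? q k = (k ≟ lifted q) ⊎-dec ((q ≟ᶠ p) ×-dec (k ≟ b))

    S : Fin n → SubsetN
    S q k = does (Lifted? q k)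

    ∈S⇔ : ∀ q k → k ∈ˢ S q ⇔ Lifted T i p q k
    ∈S⇔ q k = does≡true⇔ (Lifted? q k)

    lifted[p]<b : lifted p < b
    lifted[p]<b = punchIn-<-gap (s≤s Tp≤i)

    S[p]⇔ : ∀ k → k ∈ˢ S p ⇔ ((k ≡ lifted p) ⊎ (k ≡ b))
    S[p]⇔ k = mk⇔
      (λ k∈ → case (to (∈S⇔ p k) k∈))
      (λ { (inj₁ e) → from (∈S⇔ p k) (inj₁ e) ; (inj₂ e) → from (∈S⇔ p k) (inj₂ (refl , e)) })
      where
      case : Lifted T i p p k → (k ≡ lifted p) ⊎ (k ≡ b)
      case (inj₁ e)       = inj₁ e
      case (inj₂ (_ , e)) = inj₂ e

    S-singleton : ∀ q → q ≢ p → ∀ k → k ∈ˢ S q ⇔ (k ≡ lifted q)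
    S-singleton q q≢p k = mk⇔ (λ k∈ → case (to (∈S⇔ q k) k∈)) (λ e → from (∈S⇔ q k) (inj₁ e))
      where
      case : Lifted T i p q k → k ≡ lifted q
      case (inj₁ e)         = e
      case (inj₂ (q≡p , _)) = contradiction q≡p q≢p

    lifted-IsMin : ∀ q → IsMin (S q) (lifted q)
    lifted-IsMin q = by-cases (q ≟ᶠ p)
      where
      by-cases : Dec (q ≡ p) → IsMin (S q) (lifted q)
      by-cases (yes q≡p) = subst (λ r → IsMin (S r) (lifted r)) (sym q≡p) (pair-IsMin lifted[p]<b S[p]⇔)
      by-cases (no  q≢p) = singleton-IsMin (S-singleton q q≢p)

    disjoint : ∀ q q' k → k ∈ˢ S q → k ∈ˢ S q' → q ≡ q'
    disjoint q q' k k∈ k∈' with to (∈S⇔ q k) k∈ | to (∈S⇔ q' k) k∈'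
    ... | inj₁ e          | inj₁ e'         = T-injective q q' (punchIn-injective b (trans (sym e) e'))
    ... | inj₁ e          | inj₂ (_ , e')   = contradiction (trans (sym e) e') (punchIn≢ b (T q))
    ... | inj₂ (_ , e)    | inj₁ e'         = contradiction (trans (sym e') e) (punchIn≢ b (T q'))
    ... | inj₂ (refl , _) | inj₂ (refl , _) = refl

    covers : ∀ k → (Σ[ q ∈ Fin n ] k ∈ˢ S q) ⇔ ((1 ≤ k) × (k ≤ suc n))
    covers k = mk⇔ in-range witness
      where
      in-range : Σ[ q ∈ Fin n ] k ∈ˢ S q → (1 ≤ k) × (k ≤ suc n)
      in-range (q , k∈) with to (∈S⇔ q k) k∈
      ... | inj₁ refl       = punchIn-range (proj₁ (T-range q)) (proj₂ (T-range q))
      ... | inj₂ (_ , refl) = s≤s z≤n , s≤s i≤n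
      witness : (1 ≤ k) × (k ≤ suc n) → Σ[ q ∈ Fin n ] k ∈ˢ S q
      witness (1≤k , k≤1+n) with k ≟ b
      ... | yes k≡b = p , from (∈S⇔ p k) (inj₂ (refl , k≡b))
      ... | no  k≢b =
        let (1≤j , j≤n) = punchOut-range (s≤s z≤n) (s≤s i≤n) k≢b 1≤k k≤1+n
            (q , Tq≡) = T-surjective (punchOut b k) 1≤j j≤n
        in q , from (∈S⇔ q k) (inj₁ (sym (trans (cong (punchIn b) Tq≡) (punchIn-punchOut k≢b))))

    ordered : ∀ q q' → q ≺ q' → ∀ x y → x ∈ˢ S q → y ∈ˢ S q' → x < y
    ordered q q' q≺q' x y x∈ y∈ with to (∈S⇔ q x) x∈ | to (∈S⇔ q' y) y∈
    ... | inj₁ refl          | inj₁ refl          = punchIn-mono-< (T-monotone q q' q≺q')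
    ... | inj₁ refl          | inj₂ (refl , refl) =
      punchIn-<-gap (<-trans (T-monotone q p q≺q') (s≤s Tp≤i))
    ... | inj₂ (refl , refl) | inj₁ refl          =
      gap-<-punchIn (λ Tq'<b → nothing-above q' q≺q' (proj₁ (T-range q') , s≤s⁻¹ Tq'<b))
    ... | inj₂ (refl , refl) | inj₂ (refl , refl) = contradiction refl (proj₂ q≺q')

    size2 : HasSize2 (S p)
    size2 = lifted p , b , lifted[p]<b , S[p]⇔

    IsBarelySetValued-S : IsBarelySetValued P S
    IsBarelySetValued-S =
      (λ q → lifted q , proj₁ (lifted-IsMin q)) , disjoint , covers , ordered ,
      p , size2 , λ q q≢p → lifted q , S-singleton q q≢p

    MapsTo-S : MapsTo P S T i p
    MapsTo-S = size2 , b , pair-IsMax lifted[p]<b S[p]⇔ , refl ,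
      λ q → lifted q , lifted-IsMin q , to ≡punchOut⇔ (sym (punchOut-punchIn b (T q)))

lemma4p5 : (n : ℕ) (P : FinPoset n) →
    -- the map is well defined (single-valued) on L^{+1}(P) and lands in the target set
    ((S : Fin n → SubsetN) → IsBarelySetValued P S →
        (Σ[ T ∈ (Fin n → ℕ) ] Σ[ i ∈ ℕ ] Σ[ p ∈ Fin n ]
            MapsTo P S T i p × IsTargetTriple P T i p)
      × (∀ T i p T' i' p' → MapsTo P S T i p → MapsTo P S T' i' p' →
            (∀ q → T q ≡ T' q) × (i ≡ i') × (p ≡ p')))
    -- injective
    × ((S S' : Fin n → SubsetN) → IsBarelySetValued P S → IsBarelySetValued P S' →
        ∀ T i p → MapsTo P S T i p → MapsTo P S' T i p →
        ∀ q k → S q k ≡ S' q k)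
    -- surjective onto the target set
    × (∀ T i p → IsTargetTriple P T i p →
        Σ[ S ∈ (Fin n → SubsetN) ] IsBarelySetValued P S × MapsTo P S T i p)
lemma4p5 n P =
    (λ S bsv → let open BarelySetValued P bsv in
       (T* , i* , p* , MapsTo-T* , IsTargetTriple-T*) , MapsTo-unique P S bsv)
  , MapsTo-injective P
  , λ T i p target → let open Lift P target in S , IsBarelySetValued-S , MapsTo-S
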